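{- There is an absolute constant $C$ such that the following holds. Let $\mathcal{S}$ be any work-conserving schedule and $\mathcal{S}_{NW}$ any non-preemptive work-conserving schedule for the same instance, and let $t\in\mathbb{N}$. If $A(t,\mathcal{S})\setminus A(t,\mathcal{S}_{NW})\neq\varnothing$, then \[ |A(t,\mathcal{S}_{NW})\setminus A(t,\mathcal{S})|\;\le\; C\,P\,|A(t,\mathcal{S})\setminus A(t,\mathcal{S}_{NW})|. \]
   Context: A single machine and $n$ jobs; job $J_i$ has integer release time $r_i\ge0$ and integer processing time $p_i\ge1$; $P=\max_i p_i/\min_i p_i$. Unit slots $[t]=[t,t+1)$, $t\in\mathbb{N}$. A schedule assigns each slot to at most one job, $J_i$ receiving exactly $p_i$ slots all with $t\ge r_i$; $c_i(\mathcal{S})$ is $1$ plus the last slot of $J_i$. $J_i$ is active at time $t$ under $\mathcal{S}$ if $r_i\le t<c_i(\mathcal{S})$, and $A(t,\mathcal{S})$ is the set of indices of active jobs. A schedule is work-conserving if for every $t$, whenever some job is active at $t$, slot $[t]$ is assigned to some job; it is non-preemptive if the slots assigned to each job are consecutive. -}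

module Defs where

open import Data.Nat using (ℕ; zero; suc; _≤_; _<_; _⊔_; _⊓_; _≤?_; _<?_)
open import Data.Fin using (Fin)
open import Data.Bool using (_∧_)
open import Data.Maybe using (Maybe; just)
open import Data.List using (List; length; foldr; map; allFin)
open import Data.List.Membership.Propositional renaming (_∈_ to _∈ˡ_)
open import Data.List.Relation.Unary.Unique.Propositional using (Unique)
open import Data.Vec using (tabulate)
open import Data.Fin.Subset using (Subset)
open import Data.Product using (Σ; ∃; _×_)
open import Function.Bundles using (_⇔_)
open import Relation.Nullary using (does)
open import Relation.Binary.PropositionalEquality using (_≡_)

record Instance (n : ℕ) : Set where
  field
    r    : Fin n → ℕ
    p    : Fin n → ℕ
    p≥1  : ∀ i → 1 ≤ p i

pmax : ∀ {n} → (Fin n → ℕ) → ℕ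
pmax {n} p = foldr _⊔_ 0 (map p (allFin n))

pmin : ∀ {m} → (Fin (suc m) → ℕ) → ℕ
pmin {m} p = foldr _⊓_ (p Fin.zero) (map p (allFin (suc m)))

-- A schedule: slot [t] is assigned to at most one job (assign t = just i means
-- slot [t] goes to job i, nothing means idle).
record Schedule {n : ℕ} (I : Instance n) : Set where
  open Instance I
  field
    assign    : ℕ → Maybe (Fin n)
    slots     : Fin n → List ℕ
    slots-ok  : ∀ i t → (assign t ≡ just i) ⇔ (t ∈ˡ slots i)
    slots-uniq : ∀ i → Unique (slots i)
    slots-len : ∀ i → length (slots i) ≡ p i
    released  : ∀ i t → assign t ≡ just i → r i ≤ t

  completion : Fin n → ℕ
  completion i = suc (foldr _⊔_ 0 (slots i))

module _ {n : ℕ} {I : Instance n} where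
  open Instance I

  Active : Schedule I → Fin n → ℕ → Set
  Active S i t = r i ≤ t × t < Schedule.completion S i

  A : ℕ → Schedule I → Subset n
  A t S = tabulate (λ i → does (r i ≤? t) ∧ does (t <? Schedule.completion S i))

  WorkConserving : Schedule I → Set
  WorkConserving S = ∀ t → (∃ λ i → Active S i t) → ∃ λ j → Schedule.assign S t ≡ just j

  NonPreemptive : Schedule I → Set
  NonPreemptive S = ∀ i t u v → t ≤ u → u ≤ v →
    Schedule.assign S t ≡ just i → Schedule.assign S v ≡ just i →
    Schedule.assign S u ≡ just i

{-# OPTIONS --safe #-}
module Submission where

-- Let W(u) be the total work a schedule has processed before time u. Under a
-- work-conserving schedule the machine is busy at u exactly when W(u) is below
-- the total processing time of the jobs released by u, so W(u+1) is determined
-- by W(u) and the instance, and all work-conserving schedules share the same W.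
-- At time t, a job in A(t,SNW) ∖ A(t,S) is released and finished under S, so S
-- has spent p_k on it; comparing the work of both schedules job by job and
-- using W_S(t) = W_SNW(t) bounds the processing time of A(t,SNW) ∖ A(t,S) by
-- that of A(t,S) ∖ A(t,SNW) plus the work SNW has already spent on its active
-- jobs. Without preemption only the job running at t can be active and
-- started, so that last term is at most p_max, and C = 2 works:
--   |A(t,SNW) ∖ A(t,S)| p_min ≤ (|A(t,S) ∖ A(t,SNW)| + 1) p_max
--                             ≤ 2 p_max |A(t,S) ∖ A(t,SNW)|.

open import Defs
open import Data.Bool using (true; false; _∧_; not; if_then_else_)
open import Data.Fin using (Fin; zero; suc; _≟_)
open import Data.Fin.Subset using (Subset; _∈_; _─_; ∣_∣; Nonempty)
open import Data.Fin.Subset.Properties using (p⊆q⇒∣p∣≤∣q∣; ∣⁅x⁆∣≡1; x∈⁅y⁆⇒x≡y)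
open import Data.List using (List; []; _∷_; length; filter; foldr)
open import Data.List.Membership.Propositional using (find) renaming (_∈_ to _∈ˡ_; _∉_ to _∉ˡ_)
open import Data.List.Membership.Propositional.Properties
  using (foldr-selective; ∈-map⁺; ∈-allFin)
open import Data.List.Properties
  using (length-filter; filter-accept; filter-reject; filter-notAll; filter-none; filter-all; foldr-forcesᵇ)
open import Data.List.Relation.Unary.All as All using ()
open import Data.List.Relation.Unary.Any as Any using (Any; here; there)
open import Data.List.Relation.Unary.AllPairs using (_∷_)
open import Data.List.Relation.Unary.Unique.Propositional using (Unique)
open import Data.Maybe using (Maybe; just; nothing; is-just)
open import Data.Maybe.Properties using (just-injective)
open import Data.Nat using (ℕ; zero; suc; _+_; _*_; _≤_; _<_; _⊔_; _⊓_; _≤?_; _<?_; z≤n; s≤s; s≤s⁻¹)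
open import Data.Nat.Properties hiding (_≟_)
open import Algebra.Properties.Semiring.Sum +-*-semiring
  using (sum; sum-syntax; ∑-distrib-+; *-distribʳ-sum; sum-cong-≗; sum-replicate-zero)
open import Data.Nat.Solver using (module +-*-Solver)
open import Data.Product using (Σ; ∃; _×_; _,_)
open import Data.Sum using (inj₁; inj₂)
open import Data.Vec using (lookup; _∷_; [])
open import Data.Vec.Properties using (lookup∘tabulate)
open import Function using (_∘_; Equivalence)
open import Relation.Binary.PropositionalEquality
open import Relation.Nullary using (¬_; Dec; yes; no; does; contradiction)
open import Relation.Nullary.Decidable using (dec-true; dec-false; _×-dec_)
open import Relation.Unary using (Pred; Decidable)

sum-mono-≤ : ∀ {n} {f g : Fin n → ℕ} → (∀ k → f k ≤ g k) → sum f ≤ sum g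
sum-mono-≤ {zero}  f≤g = z≤n
sum-mono-≤ {suc n} f≤g = +-mono-≤ (f≤g zero) (sum-mono-≤ (f≤g ∘ suc))

sum-mono-< : ∀ {n} {f g : Fin n → ℕ} → (∀ k → f k ≤ g k) → ∀ j → f j < g j → sum f < sum g
sum-mono-< f≤g zero    fj<gj = +-mono-<-≤ fj<gj (sum-mono-≤ (f≤g ∘ suc))
sum-mono-< f≤g (suc j) fj<gj = +-mono-≤-< (f≤g zero) (sum-mono-< (f≤g ∘ suc) j fj<gj)

-- `with d` cannot be used when d only occurs under `does`: e.g. `does (m ≤? n)`
-- reduces to `m ≤ᵇ n`, leaving no occurrence of d to abstract.
if-does-elim : ∀ {p q} {P : Set p} (Q : ℕ → Set q) (d : Dec P) {x} →
               (P → Q x) → (¬ P → Q 0) → Q (if does d then x else 0)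
if-does-elim Q (yes p) yes-case _       = yes-case p
if-does-elim Q (no ¬p) _        no-case = no-case ¬p

subsetSum : ∀ {n} → Subset n → (Fin n → ℕ) → ℕ
subsetSum {n} v w = ∑[ k < n ] (if lookup v k then w k else 0)

subsetSum-mono-≤ : ∀ {n} (v : Subset n) {w w′ : Fin n → ℕ} →
                   (∀ k → w k ≤ w′ k) → subsetSum v w ≤ subsetSum v w′
subsetSum-mono-≤ v w≤w′ = sum-mono-≤ (λ k → if-mono (lookup v k) (w≤w′ k))
  where
  if-mono : ∀ b {x y} → x ≤ y → (if b then x else 0) ≤ (if b then y else 0)
  if-mono true  x≤y = x≤y
  if-mono false _   = z≤n

subsetSum-const : ∀ {n} (v : Subset n) c → subsetSum v (λ _ → c) ≡ ∣ v ∣ * c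
subsetSum-const []          c = refl
subsetSum-const (true ∷ v)  c = cong (c +_) (subsetSum-const v c)
subsetSum-const (false ∷ v) c = subsetSum-const v c

∣p∣*c≤subsetSum : ∀ {n} (v : Subset n) {c w} → (∀ k → c ≤ w k) → ∣ v ∣ * c ≤ subsetSum v w
∣p∣*c≤subsetSum v {c} c≤w = subst (_≤ _) (subsetSum-const v c) (subsetSum-mono-≤ v c≤w)

subsetSum≤∣p∣*c : ∀ {n} (v : Subset n) {c w} → (∀ k → w k ≤ c) → subsetSum v w ≤ ∣ v ∣ * c
subsetSum≤∣p∣*c v {c} w≤c = subst (_ ≤_) (subsetSum-const v c) (subsetSum-mono-≤ v w≤c)

nonempty⇒1≤∣p∣ : ∀ {n} {v : Subset n} → Nonempty v → 1 ≤ ∣ v ∣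
nonempty⇒1≤∣p∣ {v = v} (x , x∈v) = subst (_≤ ∣ v ∣) (∣⁅x⁆∣≡1 x)
  (p⊆q⇒∣p∣≤∣q∣ (λ y∈⁅x⁆ → subst (_∈ v) (sym (x∈⁅y⁆⇒x≡y x y∈⁅x⁆)) x∈v))

lookup-─ : ∀ {n} (v w : Subset n) k → lookup (v ─ w) k ≡ lookup v k ∧ not (lookup w k)
lookup-─ (false ∷ v) (false ∷ w) zero    = refl
lookup-─ (false ∷ v) (true  ∷ w) zero    = refl
lookup-─ (true  ∷ v) (false ∷ w) zero    = refl
lookup-─ (true  ∷ v) (true  ∷ w) zero    = refl
lookup-─ (_     ∷ v) (_     ∷ w) (suc k) = lookup-─ v w k

∈⇒≤foldr-⊔ : ∀ {x xs} → x ∈ˡ xs → x ≤ foldr _⊔_ 0 xs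
∈⇒≤foldr-⊔ {xs = xs} =
  All.lookup (foldr-forcesᵇ (λ x y ≤m → m⊔n≤o⇒m≤o x y ≤m , m⊔n≤o⇒n≤o x y ≤m) 0 xs ≤-refl)

foldr-⊓≤∈ : ∀ {x e xs} → x ∈ˡ xs → foldr _⊓_ e xs ≤ x
foldr-⊓≤∈ {e = e} {xs} =
  All.lookup (foldr-forcesᵇ (λ x y m≤ → m≤n⊓o⇒m≤n x y m≤ , m≤n⊓o⇒m≤o x y m≤) e xs ≤-refl)

≤pmax : ∀ {n} (p : Fin n → ℕ) k → p k ≤ pmax p
≤pmax p k = ∈⇒≤foldr-⊔ (∈-map⁺ p (∈-allFin k))

pmin≤ : ∀ {m} (p : Fin (suc m) → ℕ) k → pmin p ≤ p k
pmin≤ p k = foldr-⊓≤∈ (∈-map⁺ p (∈-allFin k))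

≤foldr-⊔⇒Any : ∀ {u xs} → 0 < length xs → u ≤ foldr _⊔_ 0 xs → Any (u ≤_) xs
≤foldr-⊔⇒Any {u} {x ∷ xs} _ u≤max with foldr-selective ⊔-sel 0 (x ∷ xs)
... | inj₁ max≡0 = here (≤-trans (≤-trans u≤max (≤-reflexive max≡0)) z≤n)
... | inj₂ max∈  = Any.map (λ max≡y → subst (u ≤_) max≡y u≤max) max∈

nonempty-filter⇒Any : ∀ {a p} {A : Set a} {P : Pred A p} (P? : Decidable P) xs → 0 < length (filter P? xs) → Any P xs
nonempty-filter⇒Any P? (x ∷ xs) pos with P? x
... | yes px = here px
... | no  _  = there (nonempty-filter⇒Any P? xs pos)

countBelow : ℕ → List ℕ → ℕ
countBelow u xs = length (filter (_<? u) xs)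

countBelow-cons-≢ : ∀ {u x} xs → x ≢ u → ∀ {m} → countBelow (suc u) xs ≡ m + countBelow u xs →
                    countBelow (suc u) (x ∷ xs) ≡ m + countBelow u (x ∷ xs)
countBelow-cons-≢ {u} {x} xs x≢u {m} step with x <? u
... | yes x<u = begin
  countBelow (suc u) (x ∷ xs) ≡⟨ cong length (filter-accept (_<? suc u) (m<n⇒m<1+n x<u)) ⟩
  suc (countBelow (suc u) xs) ≡⟨ cong suc step ⟩
  suc (m + countBelow u xs)   ≡⟨ sym (+-suc m _) ⟩
  m + suc (countBelow u xs)   ≡⟨ cong ((m +_) ∘ length) (sym (filter-accept (_<? u) x<u)) ⟩
  m + countBelow u (x ∷ xs)   ∎
  where open ≡-Reasoning
... | no x≮u = begin
  countBelow (suc u) (x ∷ xs) ≡⟨ cong length (filter-reject (_<? suc u) x≮1+u) ⟩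
  countBelow (suc u) xs       ≡⟨ step ⟩
  m + countBelow u xs         ≡⟨ cong ((m +_) ∘ length) (sym (filter-reject (_<? u) x≮u)) ⟩
  m + countBelow u (x ∷ xs)   ∎
  where
  open ≡-Reasoning
  x≮1+u : ¬ x < suc u
  x≮1+u x<1+u = x≢u (≤-antisym (s≤s⁻¹ x<1+u) (≮⇒≥ x≮u))

countBelow-suc-∉ : ∀ {u} xs → u ∉ˡ xs → countBelow (suc u) xs ≡ countBelow u xs
countBelow-suc-∉ []       _  = refl
countBelow-suc-∉ (x ∷ xs) u∉ =
  countBelow-cons-≢ xs (λ x≡u → u∉ (here (sym x≡u))) (countBelow-suc-∉ xs (u∉ ∘ there))

countBelow-suc-∈ : ∀ {u xs} → Unique xs → u ∈ˡ xs → countBelow (suc u) xs ≡ suc (countBelow u xs)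
countBelow-suc-∈ {u} {u ∷ xs} (u∉xs ∷ _) (here refl) = begin
  countBelow (suc u) (u ∷ xs) ≡⟨ cong length (filter-accept (_<? suc u) (n<1+n u)) ⟩
  suc (countBelow (suc u) xs) ≡⟨ cong suc (countBelow-suc-∉ xs (λ u∈xs → All.lookup u∉xs u∈xs refl)) ⟩
  suc (countBelow u xs)       ≡⟨ cong (suc ∘ length) (sym (filter-reject (_<? u) (n≮n u))) ⟩
  suc (countBelow u (u ∷ xs)) ∎
  where open ≡-Reasoning
countBelow-suc-∈ {xs = x ∷ xs} (x∉xs ∷ uniq) (there u∈xs) =
  countBelow-cons-≢ xs (All.lookup x∉xs u∈xs) (countBelow-suc-∈ uniq u∈xs)

occupies : ∀ {n} → Maybe (Fin n) → Fin n → ℕ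
occupies nothing  k = 0
occupies (just j) k = if does (j ≟ k) then 1 else 0

sum-occupies : ∀ {n} (a : Maybe (Fin n)) → sum (occupies a) ≡ (if is-just a then 1 else 0)
sum-occupies {n} nothing  = sum-replicate-zero n
sum-occupies     (just j) = sum-occupies-just j
  where
  sum-occupies-just : ∀ {n} (j : Fin n) → sum (occupies (just j)) ≡ 1
  sum-occupies-just {suc n} zero    = cong suc (sum-replicate-zero n)
  sum-occupies-just         (suc j) = sum-occupies-just j

module _ {n} {I : Instance n} where
  open Instance I

  releasedLoad : ℕ → ℕ
  releasedLoad u = ∑[ k < n ] (if does (r k ≤? u) then p k else 0)

  module _ (S : Schedule I) where
    open Schedule S

    work : Fin n → ℕ → ℕ
    work k u = countBelow u (slots k)

    totalWork : ℕ → ℕ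
    totalWork u = ∑[ k < n ] work k u

    assign⇒slot : ∀ {k u} → assign u ≡ just k → u ∈ˡ slots k
    assign⇒slot = Equivalence.to (slots-ok _ _)

    slot⇒assign : ∀ {k u} → u ∈ˡ slots k → assign u ≡ just k
    slot⇒assign = Equivalence.from (slots-ok _ _)

    slot<completion : ∀ {k x} → x ∈ˡ slots k → x < completion k
    slot<completion x∈ = s≤s (∈⇒≤foldr-⊔ x∈)

    slot-from : ∀ {k u} → u < completion k → Any (u ≤_) (slots k)
    slot-from {k} u<c = ≤foldr-⊔⇒Any (subst (0 <_) (sym (slots-len k)) (p≥1 k)) (s≤s⁻¹ u<c)

    work≤p : ∀ k u → work k u ≤ p k
    work≤p k u = subst (work k u ≤_) (slots-len k) (length-filter (_<? u) (slots k))

    work<p : ∀ {k u} → u < completion k → work k u < p k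
    work<p {k} {u} u<c = subst (work k u <_) (slots-len k)
      (filter-notAll (_<? u) (slots k) (Any.map ≤⇒≯ (slot-from u<c)))

    work-unreleased : ∀ {k u} → u ≤ r k → work k u ≡ 0
    work-unreleased {k} {u} u≤r = cong length (filter-none (_<? u)
      (All.tabulate (λ x∈ → ≤⇒≯ (≤-trans u≤r (released k _ (slot⇒assign x∈))))))

    work-completed : ∀ {k u} → completion k ≤ u → work k u ≡ p k
    work-completed {k} {u} c≤u = trans (cong length (filter-all (_<? u)
      (All.tabulate (λ x∈ → <-≤-trans (slot<completion x∈) c≤u)))) (slots-len k)

    work-inactive : ∀ {k u} → ¬ Active S k u → r k ≤ u → work k u ≡ p k
    work-inactive inactive r≤u = work-completed (≮⇒≥ (λ u<c → inactive (r≤u , u<c)))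

    work-started : ∀ {k u} → 0 < work k u → ∃ λ v → v < u × assign v ≡ just k
    work-started {k} {u} pos with find (nonempty-filter⇒Any (_<? u) (slots k) pos)
    ... | v , v∈ , v<u = v , v<u , slot⇒assign v∈

    work-suc : ∀ k u → work k (suc u) ≡ work k u + occupies (assign u) k
    work-suc k u with assign u in eq
    ... | nothing = trans
      (countBelow-suc-∉ (slots k) (λ u∈ → contradiction (trans (sym eq) (slot⇒assign u∈)) λ ()))
      (sym (+-identityʳ _))
    ... | just j with j ≟ k
    ...   | yes refl = trans (countBelow-suc-∈ (slots-uniq k) (assign⇒slot eq)) (+-comm 1 _)
    ...   | no j≢k   = trans
      (countBelow-suc-∉ (slots k) (λ u∈ → j≢k (just-injective (trans (sym eq) (slot⇒assign u∈)))))
      (sym (+-identityʳ _))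

    totalWork-zero : totalWork 0 ≡ 0
    totalWork-zero = trans (sum-cong-≗ (λ k → work-unreleased {k} z≤n)) (sum-replicate-zero n)

    totalWork-suc : ∀ u → totalWork (suc u) ≡ totalWork u + (if is-just (assign u) then 1 else 0)
    totalWork-suc u = begin
      totalWork (suc u)                              ≡⟨ sum-cong-≗ (λ k → work-suc k u) ⟩
      ∑[ k < n ] (work k u + occupies (assign u) k) ≡⟨ ∑-distrib-+ (λ k → work k u) (occupies (assign u)) ⟩
      totalWork u + sum (occupies (assign u))        ≡⟨ cong (totalWork u +_) (sum-occupies (assign u)) ⟩
      totalWork u + (if is-just (assign u) then 1 else 0) ∎
      where open ≡-Reasoning

    work≤released : ∀ k u → work k u ≤ (if does (r k ≤? u) then p k else 0)
    work≤released k u = if-does-elim (work k u ≤_) (r k ≤? u)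
      (λ _ → work≤p k u) (λ r≰u → ≤-reflexive (work-unreleased (<⇒≤ (≰⇒> r≰u))))

    busy⇔totalWork<releasedLoad : WorkConserving S → ∀ u →
      is-just (assign u) ≡ does (totalWork u <? releasedLoad u)
    busy⇔totalWork<releasedLoad wc u with assign u in eq
    ... | just j  = sym (dec-true (_ <? _) (sum-mono-< (λ k → work≤released k u) j running<released))
      where
      running<released : work j u < (if does (r j ≤? u) then p j else 0)
      running<released = if-does-elim (work j u <_) (r j ≤? u)
        (λ _ → work<p (slot<completion (assign⇒slot eq))) (contradiction (released j u eq))
    ... | nothing = sym (dec-false (_ <? _) (≤⇒≯ (sum-mono-≤ released≤work)))
      where
      released≤work : ∀ k → (if does (r k ≤? u) then p k else 0) ≤ work k u
      released≤work k = if-does-elim (_≤ work k u) (r k ≤? u)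
        (λ r≤u → ≤-reflexive (sym (work-inactive idle r≤u))) (λ _ → z≤n)
        where
        idle : ¬ Active S k u
        idle act with wc u (k , act)
        ... | _ , holds = contradiction (trans (sym eq) holds) λ ()

    totalWork-suc-wc : WorkConserving S → ∀ u →
      totalWork (suc u) ≡ totalWork u + (if does (totalWork u <? releasedLoad u) then 1 else 0)
    totalWork-suc-wc wc u =
      trans (totalWork-suc u) (cong (λ b → totalWork u + (if b then 1 else 0)) (busy⇔totalWork<releasedLoad wc u))

    started-active⇒runs : NonPreemptive S → ∀ {k u} → Active S k u → 0 < work k u → assign u ≡ just k
    started-active⇒runs np {k} {u} (_ , u<c) pos with work-started pos | find (slot-from u<c)
    ... | v , v<u , runs-v | x , x∈ , u≤x = np k v u x (<⇒≤ v<u) u≤x runs-v (slot⇒assign x∈)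

  totalWork-wc-unique : (S T : Schedule I) → WorkConserving S → WorkConserving T →
                        ∀ u → totalWork S u ≡ totalWork T u
  totalWork-wc-unique S T _ _ zero = trans (totalWork-zero S) (sym (totalWork-zero T))
  totalWork-wc-unique S T wcS wcT (suc u) = begin
    totalWork S (suc u)  ≡⟨ totalWork-suc-wc S wcS u ⟩
    next (totalWork S u) ≡⟨ cong next (totalWork-wc-unique S T wcS wcT u) ⟩
    next (totalWork T u) ≡⟨ totalWork-suc-wc T wcT u ⟨
    totalWork T (suc u)  ∎
    where
    open ≡-Reasoning
    next : ℕ → ℕ
    next w = w + (if does (w <? releasedLoad u) then 1 else 0)

  active? : (S : Schedule I) → ∀ k u → Dec (Active S k u)
  active? S k u = r k ≤? u ×-dec u <? Schedule.completion S k

  lookup-A : (S : Schedule I) → ∀ u k → lookup (A u S) k ≡ does (active? S k u)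
  lookup-A S u k = lookup∘tabulate _ k

  startedWork : Schedule I → ℕ → ℕ
  startedWork N t = subsetSum (A t N) (λ k → work N k t)

  startedWork≤pmax : (N : Schedule I) → ∀ t → NonPreemptive N → startedWork N t ≤ pmax p
  startedWork≤pmax N t np = begin
    startedWork N t                             ≤⟨ sum-mono-≤ active-work≤runs ⟩
    ∑[ k < n ] (occupies running k * pmax p)    ≡⟨ *-distribʳ-sum (pmax p) (occupies running) ⟨
    sum (occupies running) * pmax p             ≡⟨ cong (_* pmax p) (sum-occupies running) ⟩
    (if is-just running then 1 else 0) * pmax p ≤⟨ *-monoˡ-≤ (pmax p) (busy≤1 (is-just running)) ⟩
    1 * pmax p                                  ≡⟨ *-identityˡ (pmax p) ⟩
    pmax p                                      ∎
    where
    open ≤-Reasoning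
    running = Schedule.assign N t
    busy≤1 : ∀ b → (if b then 1 else 0) ≤ 1
    busy≤1 true  = ≤-refl
    busy≤1 false = z≤n
    active-work≤runs : ∀ k → (if lookup (A t N) k then work N k t else 0) ≤ occupies running k * pmax p
    active-work≤runs k = subst (λ b → (if b then work N k t else 0) ≤ occupies running k * pmax p)
      (sym (lookup-A N t k))
      (if-does-elim (_≤ occupies running k * pmax p) (active? N k t) started⇒runs (λ _ → z≤n))
      where
      started⇒runs : Active N k t → work N k t ≤ occupies running k * pmax p
      started⇒runs act with 0 <? work N k t
      ... | no  ¬started = ≤-trans (≮⇒≥ ¬started) z≤n
      ... | yes started rewrite started-active⇒runs N np act started | dec-true (k ≟ k) refl =
        ≤-trans (work≤p N k t) (≤-trans (≤pmax p k) (≤-reflexive (sym (*-identityˡ (pmax p)))))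

  module _ (S N : Schedule I) (t : ℕ) where
    job-balance : ∀ k →
      (if lookup (A t N ─ A t S) k then p k else 0) + work N k t
        ≤ (work S k t + (if lookup (A t S ─ A t N) k then p k else 0)) + (if lookup (A t N) k then work N k t else 0)
    job-balance k rewrite lookup-─ (A t N) (A t S) k | lookup-─ (A t S) (A t N) k | lookup-A N t k | lookup-A S t k =
      by-activity (active? N k t) (active? S k t)
      where
      by-activity : (aN : Dec (Active N k t)) (aS : Dec (Active S k t)) →
        (if does aN ∧ not (does aS) then p k else 0) + work N k t
          ≤ (work S k t + (if does aS ∧ not (does aN) then p k else 0)) + (if does aN then work N k t else 0)
      by-activity (yes _)         (yes _)  = m≤n+m (work N k t) _
      by-activity (yes (r≤t , _)) (no ¬aS) =
        +-monoˡ-≤ (work N k t) (≤-reflexive (sym (trans (+-identityʳ _) (work-inactive S ¬aS r≤t))))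
      by-activity (no _)          (yes _)  =
        ≤-trans (work≤p N k t) (≤-trans (m≤n+m (p k) (work S k t)) (m≤m+n _ 0))
      by-activity (no _)          (no ¬aS) with r k ≤? t
      ... | yes r≤t = ≤-trans (work≤p N k t)
                        (≤-reflexive (sym (trans (trans (+-identityʳ _) (+-identityʳ _)) (work-inactive S ¬aS r≤t))))
      ... | no  r≰t = ≤-trans (≤-reflexive (work-unreleased N (<⇒≤ (≰⇒> r≰t)))) z≤n

    load-A─A≤ : WorkConserving S → WorkConserving N →
      subsetSum (A t N ─ A t S) p ≤ subsetSum (A t S ─ A t N) p + startedWork N t
    load-A─A≤ wcS wcN = +-cancelʳ-≤ (totalWork N t) _ _ (begin
      ∑ x + totalWork N t                   ≡⟨ ∑-distrib-+ x (λ k → work N k t) ⟨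
      ∑[ k < n ] (x k + work N k t)         ≤⟨ sum-mono-≤ job-balance ⟩
      ∑[ k < n ] ((work S k t + y k) + e k) ≡⟨ ∑-distrib-+ (λ k → work S k t + y k) e ⟩
      ∑[ k < n ] (work S k t + y k) + ∑ e   ≡⟨ cong (_+ ∑ e) (∑-distrib-+ (λ k → work S k t) y) ⟩
      (totalWork S t + ∑ y) + ∑ e           ≡⟨ cong (λ w → (w + ∑ y) + ∑ e) (totalWork-wc-unique S N wcS wcN t) ⟩
      (totalWork N t + ∑ y) + ∑ e           ≡⟨ trans (+-assoc (totalWork N t) _ _) (+-comm (totalWork N t) _) ⟩
      (∑ y + ∑ e) + totalWork N t           ∎)
      where
      open ≤-Reasoning
      ∑ = sum {n}
      x y e : Fin n → ℕ
      x k = if lookup (A t N ─ A t S) k then p k else 0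
      y k = if lookup (A t S ─ A t N) k then p k else 0
      e k = if lookup (A t N) k then work N k t else 0

lemmaE4 : Σ ℕ λ C → ∀ (m : ℕ) (I : Instance (suc m)) (S SNW : Schedule I) (t : ℕ) →
    WorkConserving S → WorkConserving SNW → NonPreemptive SNW →
    Nonempty (A t S ─ A t SNW) →
    ∣ A t SNW ─ A t S ∣ * pmin (Instance.p I) ≤ C * pmax (Instance.p I) * ∣ A t S ─ A t SNW ∣
lemmaE4 = 2 , λ m I S N t wcS wcN np nonempty →
  let open Instance I
      X = A t N ─ A t S
      Y = A t S ─ A t N
      M = pmax p
      M≤∣Y∣*M : M ≤ ∣ Y ∣ * M
      M≤∣Y∣*M = ≤-trans (m≤m+n M 0) (*-monoˡ-≤ M (nonempty⇒1≤∣p∣ nonempty))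
  in begin
    ∣ X ∣ * pmin p                  ≤⟨ ∣p∣*c≤subsetSum X (pmin≤ p) ⟩
    subsetSum X p                   ≤⟨ load-A─A≤ S N t wcS wcN ⟩
    subsetSum Y p + startedWork N t ≤⟨ +-mono-≤ (subsetSum≤∣p∣*c Y (≤pmax p)) (startedWork≤pmax N t np) ⟩
    ∣ Y ∣ * M + M                   ≤⟨ +-monoʳ-≤ (∣ Y ∣ * M) M≤∣Y∣*M ⟩
    ∣ Y ∣ * M + ∣ Y ∣ * M           ≡⟨ solve 2 (λ a y → y :* a :+ y :* a := con 2 :* a :* y) refl M ∣ Y ∣ ⟩
    2 * M * ∣ Y ∣                   ∎
  where
  open ≤-Reasoning
  open +-*-Solver
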